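{- Let $L$ be a first-order language, $\Gamma$ a set of unary $L$-types, $\{M_i:i\in I\}$ a family of $L$-structures each omitting every type in $\Gamma$, and $U$ an ultrafilter on $I$. Suppose the family is $\Gamma$-nice (with respect to $U$), or more generally that $\prod^\Gamma M_i/U$ is a structure for which Łoś' Theorem holds, i.e. for every formula $\phi(\bar x)$ and $[f_1]_U,\dots,[f_n]_U\in\prod^\Gamma M_i/U$, $\{i: M_i\models\phi(f_1(i),\dots,f_n(i))\}\in U$ iff $\prod^\Gamma M_i/U\models\phi([f_1]_U,\dots,[f_n]_U)$. Then $\prod^\Gamma M_i/U$ omits every type in $\Gamma$.
   Context: A unary $L$-type is a set of $L$-formulas in one free variable $x$. A choice function on $\Gamma$ is a map $\mathcal{C}$ assigning to each $p\in\Gamma$ a formula $\mathcal{C}(p)\in p$. $\prod^\Gamma M_i$ is the set of $f\in\prod_{i\in I}M_i$ for which there are $X_f\in U$ and a choice function $\mathcal{C}$ (a witness for $f$) with $M_i\models\neg\mathcal{C}(p)(f(i))$ for all $p\in\Gamma$ and $i\in X_f$; $\prod^\Gamma M_i/U=\{[f]_U:f\in\prod^\Gamma M_i\}\subseteq\prod M_i/U$ with inherited functions and relations; it is a structure if closed under constants and functions. The family is $\Gamma$-nice if for every $L$-formula $\psi\equiv\exists x\,\phi(x,y_1,\dots,y_n)$ there is a map $g_\psi$ from $n$-tuples of choice functions to choice functions such that for all $f_1,\dots,f_n\in\prod^\Gamma M_i$ with witnesses $\mathcal{C}_1,\dots,\mathcal{C}_n$ and every $i\in I$, if $M_i\models\exists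 x\,\phi(x,f_1(i),\dots,f_n(i))$ then there is $m\in M_i$ with $M_i\models\phi(m,f_1(i),\dots,f_n(i))\wedge\neg g_\psi(\mathcal{C}_1,\dots,\mathcal{C}_n)(p)(m)$ for every $p\in\Gamma$. -}

module Defs where

open import Level using (Level; _⊔_; Lift; lift) renaming (suc to lsuc; zero to lzero)
open import Data.Nat using (ℕ; suc)
open import Data.Fin using (Fin; zero; suc)
open import Data.Product using (Σ; _×_; _,_; proj₁; proj₂)
open import Data.Sum using (_⊎_)
open import Data.Empty using (⊥)
open import Data.Unit using (⊤)
open import Relation.Nullary using (¬_)
open import Relation.Binary.PropositionalEquality using (_≡_)
open import Function.Bundles using (_⇔_)

record Language : Set₁ where
  field
    Func : ℕ → Set   -- function symbols of each arity (constants: arity 0)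
    Rel  : ℕ → Set

module _ (L : Language) where
  open Language L

  data Term (n : ℕ) : Set where
    var : Fin n → Term n
    app : ∀ {k} → Func k → (Fin k → Term n) → Term n

  data Formula : ℕ → Set where
    _≐_  : ∀ {n} → Term n → Term n → Formula n
    rel  : ∀ {n k} → Rel k → (Fin k → Term n) → Formula n
    ¬'_  : ∀ {n} → Formula n → Formula n
    _∧'_ : ∀ {n} → Formula n → Formula n → Formula n
    ∃'_  : ∀ {n} → Formula (suc n) → Formula n

-- A general structure interprets the equality symbol by a
-- relation _≈_ (needed for the ultraproduct, whose elements are
-- representatives [f]_U); an ordinary L-structure interprets = as ≡.

record Structure (L : Language) (a : Level) : Set (lsuc a) where
  open Language L
  field
    Carrier : Set a
    _≈_     : Carrier → Carrier → Set a
    funᴹ    : ∀ {k} → Func k → (Fin k → Carrier) → Carrier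
    relᴹ    : ∀ {k} → Rel k → (Fin k → Carrier) → Set a

record PlainStructure (L : Language) : Set₁ where
  open Language L
  field
    Carrier : Set
    funᴹ    : ∀ {k} → Func k → (Fin k → Carrier) → Carrier
    relᴹ    : ∀ {k} → Rel k → (Fin k → Carrier) → Set

toStructure : ∀ {L} → PlainStructure L → Structure L lzero
toStructure M = record
  { Carrier = Carrier ; _≈_ = _≡_ ; funᴹ = funᴹ ; relᴹ = relᴹ }
  where open PlainStructure M

_∷ᵉ_ : ∀ {a} {A : Set a} {n} → A → (Fin n → A) → Fin (suc n) → A
(x ∷ᵉ ρ) zero    = x
(x ∷ᵉ ρ) (suc j) = ρ j

module _ {L : Language} {a : Level} (N : Structure L a) where
  open Structure N

  eval : ∀ {n} → Term L n → (Fin n → Carrier) → Carrier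
  eval (var j)    ρ = ρ j
  eval (app F ts) ρ = funᴹ F (λ j → eval (ts j) ρ)

  Sat : ∀ {n} → Formula L n → (Fin n → Carrier) → Set a
  Sat (t ≐ u)    ρ = eval t ρ ≈ eval u ρ
  Sat (rel R ts) ρ = relᴹ R (λ j → eval (ts j) ρ)
  Sat (¬' φ)     ρ = ¬ Sat φ ρ
  Sat (φ ∧' ψ)   ρ = Sat φ ρ × Sat ψ ρ
  Sat (∃' φ)     ρ = Σ Carrier λ m → Sat φ (m ∷ᵉ ρ)

UType : Language → Set₁
UType L = Formula L 1 → Set

module _ {L : Language} {a : Level} (N : Structure L a) where
  open Structure N

  Realizes : Carrier → UType L → Set a
  Realizes m p = ∀ φ → p φ → Sat N φ (λ _ → m)

  Omits : UType L → Set a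
  Omits p = ¬ (Σ Carrier λ m → Realizes m p)

  OmitsAll : (UType L → Set) → Set (lsuc lzero ⊔ a)
  OmitsAll Γ = ∀ p → Γ p → Omits p

ChoiceFunction : ∀ {L} → (UType L → Set) → Set₁
ChoiceFunction {L} Γ = (p : UType L) → Γ p → Σ (Formula L 1) p

record Ultrafilter (I : Set) : Set₁ where
  field
    _∈U      : (I → Set) → Set
    whole    : (λ _ → ⊤) ∈U
    empty∉   : ¬ ((λ _ → ⊥) ∈U)
    upward   : ∀ {X Y : I → Set} → (∀ i → X i → Y i) → X ∈U → Y ∈U
    meet     : ∀ {X Y : I → Set} → X ∈U → Y ∈U → (λ i → X i × Y i) ∈U
    ultra    : ∀ (X : I → Set) → X ∈U ⊎ (λ i → ¬ X i) ∈U

module RestrictedUltraproduct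
  {L : Language} (Γ : UType L → Set) {I : Set} (U : Ultrafilter I)
  (M : I → PlainStructure L) where

  open Ultrafilter U
  open Language L

  Π : Set
  Π = (i : I) → PlainStructure.Carrier (M i)

  InProdΓ : Π → Set₁
  InProdΓ f = Σ (I → Set) λ X → (X ∈U) × Σ (ChoiceFunction Γ) λ C →
    ∀ p (γ : Γ p) i → X i →
      ¬ Sat (toStructure (M i)) (proj₁ (C p γ)) (λ _ → f i)

  ProdΓ : Set₁
  ProdΓ = Σ Π InProdΓ

  _~U_ : Π → Π → Set
  f ~U g = (λ i → f i ≡ g i) ∈U

  IsStructure : Set₁
  IsStructure = ∀ {k} (F : Func k) (fs : Fin k → ProdΓ) →
    Σ ProdΓ λ g →
      proj₁ g ~U (λ i → PlainStructure.funᴹ (M i) F (λ j → proj₁ (fs j) i))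

  ultraproduct : IsStructure → Structure L (lsuc lzero)
  ultraproduct S = record
    { Carrier = ProdΓ
    ; _≈_     = λ f g → Lift _ (proj₁ f ~U proj₁ g)
    ; funᴹ    = λ F fs → proj₁ (S F fs)
    ; relᴹ    = λ R fs →
        Lift _ ((λ i → PlainStructure.relᴹ (M i) R (λ j → proj₁ (fs j) i)) ∈U)
    }

  Łoś : IsStructure → Set₁
  Łoś S = ∀ {n} (φ : Formula L n) (fs : Fin n → ProdΓ) →
    Lift (lsuc lzero) ((λ i → Sat (toStructure (M i)) φ (λ j → proj₁ (fs j) i)) ∈U)
      ⇔ Sat (ultraproduct S) φ fs

{-# OPTIONS --safe #-}
-- If [f]_U realized p ∈ Γ, then in particular it would satisfy C(p) for the
-- witness C of f, so by Łoś the set {i : M_i ⊨ C(p)(f(i))} would be in U;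
-- but it is disjoint from X_f ∈ U.
module Submission where

open import Defs
open import Level using (lower)
open import Data.Product using (_,_; proj₁; proj₂)
open import Function.Bundles using (Equivalence)
open import Relation.Nullary using (¬_)

module _ {I : Set} (U : Ultrafilter I) where
  open Ultrafilter U

  disjoint⇒¬both∈U : ∀ {X Y : I → Set} → (∀ i → X i → ¬ Y i) → X ∈U → ¬ (Y ∈U)
  disjoint⇒¬both∈U disjoint X∈U Y∈U =
    empty∉ (upward (λ i (x , y) → disjoint i x y) (meet X∈U Y∈U))

module _ {L : Language} (Γ : UType L → Set) {I : Set} (U : Ultrafilter I)
         (M : I → PlainStructure L) where
  open RestrictedUltraproduct Γ U M

  witness : ProdΓ → ChoiceFunction Γ
  witness (_ , _ , _ , C , _) = C

  ultraproduct-falsifies-witness : (S : IsStructure) → Łoś S →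
    (g : ProdΓ) (p : UType L) (γ : Γ p) →
    ¬ Sat (ultraproduct S) (proj₁ (witness g p γ)) (λ _ → g)
  ultraproduct-falsifies-witness S łoś g@(_ , X , X∈U , C , fails) p γ sat =
    disjoint⇒¬both∈U U (fails p γ) X∈U
      (lower (Equivalence.from (łoś (proj₁ (C p γ)) (λ _ → g)) sat))

proposition2p11 : (L : Language) (Γ : UType L → Set) (I : Set) (U : Ultrafilter I)
    (M : I → PlainStructure L) →
    (∀ i → OmitsAll (toStructure (M i)) Γ) →
    (S : RestrictedUltraproduct.IsStructure Γ U M) →
    RestrictedUltraproduct.Łoś Γ U M S →
    OmitsAll (RestrictedUltraproduct.ultraproduct Γ U M S) Γ
proposition2p11 L Γ I U M _ S łoś p γ (g , realizes) =
  ultraproduct-falsifies-witness Γ U M S łoś g p γ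
    (realizes _ (proj₂ (witness Γ U M g p γ)))
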